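{- Let $0<c_1,c_2<1$ and $\eta>0$ be constants and let $m$ be a sufficiently large integer. Let $H$ be a $3$-uniform hypergraph on vertex set $A\cup B$ with $A\cap B=\emptyset$, in which every edge consists of one vertex of $A$ and two vertices of $B$, where $|A|=c_1m$ and $|B|\geq c_2 2^{m^2}$. If $$d_3\!\left(A,\tbinom{B}{2}\right):=\frac{|E(H)|}{|A|\binom{|B|}{2}}\geq\eta,$$ then there exist $A'\subseteq A$ and disjoint subsets $B',B''\subseteq B$ with $|A'|=|B'|=|B''|=\eta|A|/2$ such that every triple $\{a,b,b'\}$ with $a\in A'$, $b\in B'$, $b'\in B''$ is an edge of $H$.
   Formalization: The constants $c_1$, $c_2$ and $\eta$ take rational values. -}

module Defs where

open import Data.Nat using (ℕ; _<ᵇ_)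
import Data.Nat
open import Data.Nat.Combinatorics using (_C_)
open import Data.Integer using (+_)
open import Data.Rational using (ℚ; _/_; _*_)
open import Data.Bool using (Bool; true; false; if_then_else_; _∧_)
open import Data.Fin using (Fin; toℕ)
open import Data.List using (map; allFin)
open import Data.Nat.ListAction using (sum)
open import Relation.Binary.PropositionalEquality using (_≡_)

toℚ : ℕ → ℚ
toℚ n = + n / 1

-- A 3-uniform hypergraph on A ∪ B (A = Fin a, B = Fin b, disjoint by construction)
-- in which every edge has one vertex in A and two (distinct) vertices in B.
-- Well-formedness (edges are sets): symmetric in y,z and no edge with y = z.
record ABHypergraph (a b : ℕ) : Set where
  field
    E     : Fin a → Fin b → Fin b → Bool
    sym   : ∀ x y z → E x y z ≡ E x z y
    irrefl : ∀ x y → E x y y ≡ false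

open ABHypergraph public

-- |E(H)| : count each edge {x,y,z} once, via the ordered representative y < z
edgeCount : ∀ {a b} → ABHypergraph a b → ℕ
edgeCount {a} {b} H =
  sum (map (λ x → sum (map (λ y → sum (map (λ z →
    if (toℕ y <ᵇ toℕ z) ∧ E H x y z then 1 else 0) (allFin b))) (allFin b))) (allFin a))

maxEdges : ℕ → ℕ → ℕ
maxEdges a b = a Data.Nat.* (b C 2)

module Submission where

-- Write η = p/q and let t = ⌊pa/2q⌋ + 1 where a = |A|, so that ηa/2 ≤ t.
--  1. HeavyPairs: double counting |E(H)| over the pairs {y, z} of B, the
--     pairs of codegree ≥ t (heavy pairs) are at least a p/2q fraction.
--  2. LinkClasses: grouping the heavy pairs by their link {x : xyz ∈ E(H)}
--     and halving once per vertex of A, one link class keeps a 2⁻ᵃ fraction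
--     of them; its common link A′ has at least t elements.
--  3. CompleteBipartite: the class, as a graph on B, has density about
--     1/(8q·2ᵃ); a greedy Kővári–Sós–Turán embedding finds disjoint B′, B″
--     with |B′| = t ≤ |B″| and every pair of B′ × B″ in the class, provided
--     |B| is at least 'required a q t'.
--  4. LargeSize: |B| ≥ c₂·2^(m²) with |A| = c₁m, c₁ < 1, exceeds this
--     requirement 2^(a² + O(a)) once m is large.

module Counting where

  open import Data.Nat using (ℕ; zero; suc; _+_; _*_; _^_; _≤_; _<_; _<ᵇ_; _≤ᵇ_; z≤n; s≤s)
  open import Data.Nat.Tactic.RingSolver using (solve-∀)
  open import Data.Nat.Properties
  open import Data.Fin using (Fin; zero; suc)
  open import Data.Bool using (Bool; true; false; T; if_then_else_; _∧_)
  open import Data.Unit using (tt)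
  open import Data.List using (map; allFin; tabulate)
  open import Data.List.Properties using (map-tabulate)
  import Data.Nat.ListAction as List
  open import Data.Product using (∃; _,_)
  open import Relation.Binary.PropositionalEquality
  open import Relation.Nullary using (yes; no)
  open import Algebra.Properties.Semiring.Sum +-*-semiring public
    using (sum; sum-syntax; ∑-comm; ∑-distrib-+; *-distribˡ-sum)

  sum-allFin : ∀ n (f : Fin n → ℕ) → List.sum (map f (allFin n)) ≡ ∑[ i < n ] f i
  sum-allFin n f = trans (cong List.sum (map-tabulate (λ i → i) f)) (sum-tabulate n)
    where
    sum-tabulate : ∀ k {g : Fin k → ℕ} → List.sum (tabulate g) ≡ sum g
    sum-tabulate zero = refl
    sum-tabulate (suc k) {g} = cong (g zero +_) (sum-tabulate k)

  ∑-cong : ∀ {n} {f g : Fin n → ℕ} → (∀ i → f i ≡ g i) → sum f ≡ sum g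
  ∑-cong {zero} eq = refl
  ∑-cong {suc n} eq = cong₂ _+_ (eq zero) (∑-cong (λ i → eq (suc i)))

  ∑-mono-≤ : ∀ {n} {f g : Fin n → ℕ} → (∀ i → f i ≤ g i) → sum f ≤ sum g
  ∑-mono-≤ {zero} le = z≤n
  ∑-mono-≤ {suc n} le = +-mono-≤ (le zero) (∑-mono-≤ (λ i → le (suc i)))

  ∑-const : ∀ n c → ∑[ i < n ] c ≡ n * c
  ∑-const zero c = refl
  ∑-const (suc n) c = cong (c +_) (∑-const n c)

  ∑-positive : ∀ {n} (f : Fin n → ℕ) → 0 < sum f → ∃ λ i → 0 < f i
  ∑-positive {suc n} f pos with f zero in eq
  ... | suc _ = zero , subst (0 <_) (sym eq) (s≤s z≤n)
  ... | zero with ∑-positive (λ i → f (suc i)) pos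
  ...   | i , fi>0 = suc i , fi>0

  ∑-≤-max : ∀ {n} (f : Fin n → ℕ) → 0 < sum f → ∃ λ i → sum f ≤ n * f i
  ∑-≤-max {suc n} f pos with sum (λ i → f (suc i)) in eq
  ... | zero = zero , subst (_≤ suc n * f zero) (sym (+-identityʳ (f zero)))
                            (m≤m+n (f zero) (n * f zero))
  ... | suc _ with ∑-≤-max (λ i → f (suc i)) (subst (0 <_) (sym eq) (s≤s z≤n))
  ...   | j , tail≤ with f zero ≤? f (suc j)
  ...     | yes f₀≤ = suc j , +-mono-≤ f₀≤ (subst (_≤ n * f (suc j)) eq tail≤)
  ...     | no f₀≰ = zero , +-monoʳ-≤ (f zero)
                       (≤-trans (subst (_≤ n * f (suc j)) eq tail≤) (*-monoʳ-≤ n (<⇒≤ (≰⇒> f₀≰))))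

  2*n≡n+n : ∀ n → 2 * n ≡ n + n
  2*n≡n+n n = cong (n +_) (+-identityʳ n)

  ^-distribʳ-* : ∀ x y n → (x * y) ^ n ≡ x ^ n * y ^ n
  ^-distribʳ-* x y zero = refl
  ^-distribʳ-* x y (suc n) =
    trans (cong (x * y *_) (^-distribʳ-* x y n)) (interchange x y (x ^ n) (y ^ n))
    where
    interchange : ∀ x y u v → x * y * (u * v) ≡ x * u * (y * v)
    interchange = solve-∀

  m*n>0⇒n>0 : ∀ m {n} → 0 < m * n → 0 < n
  m*n>0⇒n>0 m {zero} pos = subst (0 <_) (*-zeroʳ m) pos
  m*n>0⇒n>0 m {suc n} _ = s≤s z≤n

  <ᵇ-true : ∀ {m n} → (m <ᵇ n) ≡ true → m < n
  <ᵇ-true {m} {n} eq = <ᵇ⇒< m n (subst T (sym eq) tt)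

  <ᵇ-false : ∀ {m n} → (m <ᵇ n) ≡ false → n ≤ m
  <ᵇ-false eq = ≮⇒≥ (λ m<n → subst T eq (<⇒<ᵇ m<n))

  ≤ᵇ-true : ∀ {m n} → (m ≤ᵇ n) ≡ true → m ≤ n
  ≤ᵇ-true {m} {n} eq = ≤ᵇ⇒≤ m n (subst T (sym eq) tt)

  ≤ᵇ-false : ∀ {m n} → (m ≤ᵇ n) ≡ false → n < m
  ≤ᵇ-false eq = ≰⇒> (λ m≤n → subst T eq (≤⇒≤ᵇ m≤n))

  ∧-true₁ : ∀ {u v} → u ∧ v ≡ true → u ≡ true
  ∧-true₁ {true} _ = refl

  ∧-true₂ : ∀ {u v} → u ∧ v ≡ true → v ≡ true
  ∧-true₂ {true} holds = holds

  χ : Bool → ℕ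
  χ u = if u then 1 else 0

  χ-∧ : ∀ u v → χ (u ∧ v) ≡ χ u * χ v
  χ-∧ true v = sym (+-identityʳ (χ v))
  χ-∧ false v = refl

  χ≤1 : ∀ u → χ u ≤ 1
  χ≤1 true = s≤s z≤n
  χ≤1 false = z≤n

  count : ∀ {n} → (Fin n → Bool) → ℕ
  count {n} P = ∑[ i < n ] χ (P i)

  count≤n : ∀ {n} (P : Fin n → Bool) → count P ≤ n
  count≤n {n} P = begin
    count P         ≤⟨ ∑-mono-≤ (λ i → χ≤1 (P i)) ⟩
    ∑[ i < n ] 1    ≡⟨ ∑-const n 1 ⟩
    n * 1           ≡⟨ *-identityʳ n ⟩
    n               ∎
    where open ≤-Reasoning

  count₂ : ∀ {n} → (Fin n → Fin n → Bool) → ℕ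
  count₂ {n} P = ∑[ y < n ] count (P y)

  count-witness : ∀ {n} (P : Fin n → Bool) → 0 < count P → ∃ λ i → P i ≡ true
  count-witness P pos with ∑-positive (λ i → χ (P i)) pos
  ... | i , χ>0 with P i in eq
  ...   | true = i , eq

module RationalBridge where

  open import Defs using (toℚ)
  open import Data.Nat using (ℕ; suc)
  import Data.Nat as ℕ
  import Data.Nat.Properties as ℕ
  open import Data.Nat.Coprimality using (Coprime)
  open import Data.Integer using (+_)
  import Data.Integer as ℤ
  import Data.Integer.Properties as ℤ
  open import Data.Rational using (ℚ; mkℚ; 0ℚ; 1ℚ; _≤_; _<_; _*_; toℚᵘ; *<*)
  import Data.Rational.Properties as ℚ
  import Data.Rational.Unnormalised as ℚᵘ
  import Data.Rational.Unnormalised.Properties as ℚᵘ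
  open import Relation.Binary.PropositionalEquality

  data PositiveView : ℚ → Set where
    positive : ∀ n d .(c : Coprime (suc n) (suc d)) → PositiveView (mkℚ (+ suc n) d c)

  positiveView : ∀ r → 0ℚ < r → PositiveView r
  positiveView (mkℚ (+ suc n) d c) _ = positive n d c
  positiveView (mkℚ (+ 0) d c) (*<* (ℤ.+<+ ()))
  positiveView (mkℚ ℤ.-[1+ n ] d c) (*<* ())

  fraction<1 : ∀ s d .(c : Coprime s (suc d)) → mkℚ (+ s) d c < 1ℚ → s ℕ.< suc d
  fraction<1 s d c (*<* lt) =
    ℤ.drop‿+<+ (subst₂ ℤ._<_ (ℤ.*-identityʳ (+ s)) (ℤ.*-identityˡ (+ suc d)) lt)

  -- Comparing (s / (1 + d)) · X with Y amounts to comparing s · X with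
  -- (1 + d) · Y: in unnormalised rationals ≤ is cross-multiplication.
  module _ (s d : ℕ) .(c : Coprime s (suc d)) where

    private
      r : ℚ
      r = mkℚ (+ s) d c

      toℚᵘ-toℚ : ∀ X → toℚᵘ (toℚ X) ℚᵘ.≃ ℚᵘ.mkℚᵘ (+ X) 0
      toℚᵘ-toℚ X = ℚ.toℚᵘ-fromℚᵘ (ℚᵘ.mkℚᵘ (+ X) 0)

      toℚᵘ-scaled : ∀ X → toℚᵘ (r * toℚ X) ℚᵘ.≃ ℚᵘ.mkℚᵘ (+ s) d ℚᵘ.* ℚᵘ.mkℚᵘ (+ X) 0
      toℚᵘ-scaled X = ℚᵘ.≃-trans (ℚ.toℚᵘ-homo-* r (toℚ X))
                        (ℚᵘ.*-cong {x = ℚᵘ.mkℚᵘ (+ s) d} ℚᵘ.≃-refl (toℚᵘ-toℚ X))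

      scaled-numerator : ∀ X → (+ s ℤ.* + X) ℤ.* + 1 ≡ + (s ℕ.* X)
      scaled-numerator X = trans (ℤ.*-identityʳ _) (sym (ℤ.pos-* s X))

      cross-multiplied : ∀ Y → + Y ℤ.* + (suc d ℕ.* 1) ≡ + (suc d ℕ.* Y)
      cross-multiplied Y = trans (sym (ℤ.pos-* Y _))
        (cong +_ (trans (cong (Y ℕ.*_) (ℕ.*-identityʳ (suc d))) (ℕ.*-comm Y (suc d))))

    scaled≤⇒ : ∀ X Y → r * toℚ X ≤ toℚ Y → s ℕ.* X ℕ.≤ suc d ℕ.* Y
    scaled≤⇒ X Y le
      with ℚᵘ.≤-respʳ-≃ (toℚᵘ-toℚ Y) (ℚᵘ.≤-respˡ-≃ (toℚᵘ-scaled X) (ℚ.toℚᵘ-mono-≤ le))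
    ... | ℚᵘ.*≤* le′ =
      ℤ.drop‿+≤+ (subst₂ ℤ._≤_ (scaled-numerator X) (cross-multiplied Y) le′)

    ⇒scaled≤ : ∀ X Y → s ℕ.* X ℕ.≤ suc d ℕ.* Y → r * toℚ X ≤ toℚ Y
    ⇒scaled≤ X Y le = ℚ.toℚᵘ-cancel-≤
      (ℚᵘ.≤-respʳ-≃ (ℚᵘ.≃-sym (toℚᵘ-toℚ Y)) (ℚᵘ.≤-respˡ-≃ (ℚᵘ.≃-sym (toℚᵘ-scaled X))
        (ℚᵘ.*≤* (subst₂ ℤ._≤_ (sym (scaled-numerator X)) (sym (cross-multiplied Y))
                                 (ℤ.+≤+ le)))))

    ≤scaled⇒ : ∀ X Y → toℚ Y ≤ r * toℚ X → suc d ℕ.* Y ℕ.≤ s ℕ.* X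
    ≤scaled⇒ X Y le
      with ℚᵘ.≤-respˡ-≃ (toℚᵘ-toℚ Y) (ℚᵘ.≤-respʳ-≃ (toℚᵘ-scaled X) (ℚ.toℚᵘ-mono-≤ le))
    ... | ℚᵘ.*≤* le′ =
      ℤ.drop‿+≤+ (subst₂ ℤ._≤_ (cross-multiplied Y) (scaled-numerator X) le′)

module HeavyPairs where

  open import Defs using (ABHypergraph; E; edgeCount)
  open Counting
  open import Data.Nat using (ℕ; zero; suc; _+_; _*_; _≤_; _<_; z≤n; s≤s; pred; _<ᵇ_; >-nonZero)
  open import Data.Nat.Properties
  open import Data.Nat.Combinatorics using (_C_; nC1≡n; nCk+nC[k+1]≡[n+1]C[k+1])
  open import Data.Nat.Tactic.RingSolver using (solve-∀)
  open import Data.Fin using (Fin; zero; suc; toℕ)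
  open import Data.Bool using (Bool; true; false; _∧_)
  open import Data.Empty using (⊥)
  open import Relation.Binary.PropositionalEquality

  -- Pairs of vertices of 'Fin b' are counted once, through the representative y < z.
  ordered : ∀ {b} → Fin b → Fin b → Bool
  ordered y z = toℕ y <ᵇ toℕ z

  ordered-irrefl : ∀ {b} (y : Fin b) → ordered y y ≡ true → ⊥
  ordered-irrefl y eq = <-irrefl refl (<ᵇ-true {toℕ y} eq)

  count₂-ordered : ∀ b → count₂ (ordered {b}) ≡ b C 2
  count₂-ordered zero = refl
  count₂-ordered (suc b) = begin
    count₂ (ordered {suc b})                    ≡⟨ cong₂ _+_ first-row (count₂-ordered b) ⟩
    b + b C 2                                   ≡⟨ cong (_+ b C 2) (sym (nC1≡n b)) ⟩
    b C 1 + b C 2                               ≡⟨ nCk+nC[k+1]≡[n+1]C[k+1] b 1 ⟩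
    suc b C 2                                   ∎
    where
    open ≡-Reasoning
    -- vertex 0 precedes each of the other b vertices
    first-row : count (ordered {suc b} zero) ≡ b
    first-row = trans (∑-const b 1) (*-identityʳ b)

  double-C2 : ∀ b → 2 * (b C 2) ≡ b * pred b
  double-C2 zero = refl
  double-C2 (suc zero) = refl
  double-C2 (suc (suc b)) = begin
    2 * (suc (suc b) C 2)       ≡⟨ cong (2 *_) (sym (nCk+nC[k+1]≡[n+1]C[k+1] (suc b) 1)) ⟩
    2 * (suc b C 1 + suc b C 2) ≡⟨ cong (λ n → 2 * (n + suc b C 2)) (nC1≡n (suc b)) ⟩
    2 * (suc b + suc b C 2)     ≡⟨ *-distribˡ-+ 2 (suc b) _ ⟩
    2 * suc b + 2 * (suc b C 2) ≡⟨ cong (2 * suc b +_) (double-C2 (suc b)) ⟩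
    2 * suc b + suc b * b       ≡⟨ shift b ⟩
    suc (suc b) * suc b         ∎
    where
    open ≡-Reasoning
    shift : ∀ b → 2 * suc b + suc b * b ≡ suc (suc b) * suc b
    shift = solve-∀

  1≤C2 : ∀ b → 2 ≤ b → 1 ≤ b C 2
  1≤C2 (suc b) (s≤s 1≤b) = begin
    1             ≤⟨ 1≤b ⟩
    b             ≡⟨ sym (nC1≡n b) ⟩
    b C 1         ≤⟨ m≤m+n (b C 1) (b C 2) ⟩
    b C 1 + b C 2 ≡⟨ nCk+nC[k+1]≡[n+1]C[k+1] b 1 ⟩
    suc b C 2     ∎
    where open ≤-Reasoning

  module _ {a b : ℕ} (H : ABHypergraph a b) where

    codegree : Fin b → Fin b → ℕ
    codegree y z = count (λ x → E H x y z)

    edgeCount-codegrees : edgeCount H ≡ ∑[ y < b ] ∑[ z < b ] (χ (ordered y z) * codegree y z)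
    edgeCount-codegrees = begin
      edgeCount H
        ≡⟨ trans (sum-allFin a _) (∑-cong (λ x → trans (sum-allFin b _) (∑-cong (λ y →
             sum-allFin b (λ z → χ (ordered y z ∧ E H x y z)))))) ⟩
      ∑[ x < a ] ∑[ y < b ] ∑[ z < b ] χ (ordered y z ∧ E H x y z)
        ≡⟨ trans (∑-comm (λ x y → ∑[ z < b ] χ (ordered y z ∧ E H x y z)))
                 (∑-cong (λ y → ∑-comm (λ x z → χ (ordered y z ∧ E H x y z)))) ⟩
      ∑[ y < b ] ∑[ z < b ] ∑[ x < a ] χ (ordered y z ∧ E H x y z)
        ≡⟨ ∑-cong (λ y → ∑-cong (λ z → factor (ordered y z) (λ x → E H x y z))) ⟩
      ∑[ y < b ] ∑[ z < b ] (χ (ordered y z) * codegree y z) ∎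
      where
      open ≡-Reasoning
      factor : ∀ u (e : Fin a → Bool) → ∑[ x < a ] χ (u ∧ e x) ≡ χ u * count e
      factor u e = trans (∑-cong (λ x → χ-∧ u (e x)))
                         (sym (*-distribˡ-sum (χ u) (λ x → χ (e x))))

    heavy : ℕ → Fin b → Fin b → Bool
    heavy τ y z = ordered y z ∧ (τ <ᵇ codegree y z)

    -- Each ordered pair contributes at most a if heavy and at most τ otherwise,
    -- so |E(H)| ≤ a · #heavy + τ · (b choose 2).
    edgeCount-heavy : ∀ τ → edgeCount H ≤ a * count₂ (heavy τ) + τ * (b C 2)
    edgeCount-heavy τ = begin
      edgeCount H
        ≡⟨ edgeCount-codegrees ⟩
      ∑[ y < b ] ∑[ z < b ] (χ (ordered y z) * codegree y z)
        ≤⟨ ∑-mono-≤ (λ y → ∑-mono-≤ (λ z → contribution y z)) ⟩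
      ∑[ y < b ] ∑[ z < b ] (a * χ (heavy τ y z) + τ * χ (ordered y z))
        ≡⟨ trans (∑-cong (λ y → split (λ z → χ (heavy τ y z)) (λ z → χ (ordered y z))))
                 (split (λ y → count (heavy τ y)) (λ y → count (ordered y))) ⟩
      a * count₂ (heavy τ) + τ * count₂ (ordered {b})
        ≡⟨ cong (λ n → a * count₂ (heavy τ) + τ * n) (count₂-ordered b) ⟩
      a * count₂ (heavy τ) + τ * (b C 2) ∎
      where
      open ≤-Reasoning
      split : ∀ {n} (f g : Fin n → ℕ) → ∑[ i < n ] (a * f i + τ * g i) ≡ a * sum f + τ * sum g
      split f g = trans (∑-distrib-+ (λ i → a * f i) (λ i → τ * g i))
                        (sym (cong₂ _+_ (*-distribˡ-sum a f) (*-distribˡ-sum τ g)))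
      contribution : ∀ y z → χ (ordered y z) * codegree y z ≤ a * χ (heavy τ y z) + τ * χ (ordered y z)
      contribution y z with ordered y z | τ <ᵇ codegree y z in light?
      ... | false | _ = z≤n
      ... | true | true = begin
        codegree y z + 0 ≡⟨ +-identityʳ _ ⟩
        codegree y z     ≤⟨ count≤n _ ⟩
        a                ≡⟨ sym (*-identityʳ a) ⟩
        a * 1            ≤⟨ m≤m+n (a * 1) (τ * 1) ⟩
        a * 1 + τ * 1    ∎
      ... | true | false = begin
        codegree y z + 0 ≡⟨ +-identityʳ _ ⟩
        codegree y z     ≤⟨ <ᵇ-false light? ⟩
        τ                ≡⟨ sym (*-identityʳ τ) ⟩
        τ * 1            ≤⟨ m≤n+m (τ * 1) (a * 0) ⟩
        a * 0 + τ * 1    ∎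

    -- If |E(H)| ≥ (p/q)·a·(b choose 2) and τ ≤ pa/2q, then at least a p/2q
    -- fraction of all pairs are heavy: light pairs account for at most half
    -- of the required edges.
    heavy-pairs-dense : ∀ p q τ → 0 < a → 2 * q * τ ≤ p * a →
      p * (a * (b C 2)) ≤ q * edgeCount H → p * (b C 2) ≤ 2 * q * count₂ (heavy τ)
    heavy-pairs-dense p q τ a>0 τ-small dense =
      *-cancelˡ-≤ a {{>-nonZero a>0}} (+-cancelʳ-≤ (p * a * C₂) _ _ (begin
        a * (p * C₂) + p * a * C₂          ≡⟨ regroup₁ a p C₂ ⟩
        2 * (p * (a * C₂))                 ≤⟨ *-monoʳ-≤ 2 dense ⟩
        2 * (q * edgeCount H)              ≤⟨ *-monoʳ-≤ 2 (*-monoʳ-≤ q (edgeCount-heavy τ)) ⟩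
        2 * (q * (a * G + τ * C₂))         ≡⟨ regroup₂ q a G τ C₂ ⟩
        a * (2 * q * G) + 2 * q * τ * C₂   ≤⟨ +-monoʳ-≤ (a * (2 * q * G)) (*-monoˡ-≤ C₂ τ-small) ⟩
        a * (2 * q * G) + p * a * C₂       ∎))
      where
      open ≤-Reasoning
      C₂ G : ℕ
      C₂ = b C 2
      G = count₂ (heavy τ)
      regroup₁ : ∀ a p c → a * (p * c) + p * a * c ≡ 2 * (p * (a * c))
      regroup₁ = solve-∀
      regroup₂ : ∀ q a g s c → 2 * (q * (a * g + s * c)) ≡ a * (2 * q * g) + 2 * q * s * c
      regroup₂ = solve-∀

module LinkClasses where

  open Counting
  open import Data.Nat using (ℕ; _+_; _*_; _^_; _≤_)
  open import Data.Nat.Properties hiding (_≟_)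
  open import Data.Fin using (Fin)
  open import Data.Bool using (Bool; true; false; _∧_)
  open import Data.Bool.Properties using (_≟_; ∧-assoc; ∧-identityʳ)
  open import Data.List using (List; []; _∷_; map; length)
  open import Data.List.Membership.Propositional using (_∈_)
  open import Data.List.Relation.Unary.Any using (here; there)
  open import Data.List.Membership.Propositional.Properties using (∈-map⁻)
  open import Data.Product using (Σ; ∃; _×_; _,_; proj₁)
  open import Data.Sum using (_⊎_; inj₁; inj₂)
  open import Relation.Binary.PropositionalEquality
  open import Relation.Nullary using (does; yes; no)

  larger-half : ∀ u v → u + v ≤ 2 * u ⊎ u + v ≤ 2 * v
  larger-half u v with u ≤? v
  ... | yes u≤v = inj₂ (≤-trans (+-monoˡ-≤ v u≤v) (≤-reflexive (sym (2*n≡n+n v))))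
  ... | no u≰v = inj₁ (≤-trans (+-monoʳ-≤ u (<⇒≤ (≰⇒> u≰v))) (≤-reflexive (sym (2*n≡n+n u))))

  -- A pattern
  -- prescribes answers to some tests; iteratively keeping the larger half of the
  -- pairs shows that some pattern on k tests is followed by a 2⁻ᵏ-fraction of them.
  module _ {I : Set} {b : ℕ} (test : I → Fin b → Fin b → Bool) where

    follows : List (I × Bool) → Fin b → Fin b → Bool
    follows [] y z = true
    follows ((i , β) ∷ σ) y z = does (test i y z ≟ β) ∧ follows σ y z

    follows-sound : ∀ σ {y z} → follows σ y z ≡ true → ∀ {i β} → (i , β) ∈ σ → test i y z ≡ β
    follows-sound ((i , β) ∷ σ) {y} {z} holds at with test i y z ≟ β | at
    ... | yes answer | here refl = answer
    ... | yes _ | there at′ = follows-sound σ holds at′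

    same-answers : ∀ σ {y z y′ z′} → follows σ y z ≡ true → follows σ y′ z′ ≡ true →
      ∀ {i} → i ∈ map proj₁ σ → test i y z ≡ test i y′ z′
    same-answers σ holds holds′ at with ∈-map⁻ proj₁ at
    ... | (i , β) , at′ , refl = trans (follows-sound σ holds at′) (sym (follows-sound σ holds′ at′))

    private
      refine : (Fin b → Fin b → Bool) → I → Bool → Fin b → Fin b → Bool
      refine P i β y z = P y z ∧ does (test i y z ≟ β)

      split : ∀ P i → count₂ P ≡ count₂ (refine P i true) + count₂ (refine P i false)
      split P i = trans
        (∑-cong (λ y → trans (∑-cong (λ z → pointwise (P y z) (test i y z)))
                             (∑-distrib-+ (λ z → χ (refine P i true y z)) (λ z → χ (refine P i false y z)))))
        (∑-distrib-+ (λ y → count (refine P i true y)) (λ y → count (refine P i false y)))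
        where
        pointwise : ∀ u e → χ u ≡ χ (u ∧ does (e ≟ true)) + χ (u ∧ does (e ≟ false))
        pointwise true true = refl
        pointwise true false = refl
        pointwise false e = refl

      larger-answer : ∀ P i → ∃ λ β → count₂ P ≤ 2 * count₂ (refine P i β)
      larger-answer P i with larger-half (count₂ (refine P i true)) (count₂ (refine P i false))
      ... | inj₁ half = true , subst (_≤ 2 * count₂ (refine P i true)) (sym (split P i)) half
      ... | inj₂ half = false , subst (_≤ 2 * count₂ (refine P i false)) (sym (split P i)) half

    Concentrated : List I → (Fin b → Fin b → Bool) → Set
    Concentrated xs P = Σ (List (I × Bool)) λ σ →
      map proj₁ σ ≡ xs × count₂ P ≤ 2 ^ length xs * count₂ (λ y z → P y z ∧ follows σ y z)

    private
      extend : ∀ {xs P} i β → count₂ P ≤ 2 * count₂ (refine P i β) →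
        Concentrated xs (refine P i β) → Concentrated (i ∷ xs) P
      extend {xs} {P} i β half (σ , σ-tests , bound) = (i , β) ∷ σ , cong (i ∷_) σ-tests , (begin
        count₂ P                                        ≤⟨ half ⟩
        2 * count₂ (refine P i β)                       ≤⟨ *-monoʳ-≤ 2 bound ⟩
        2 * (2 ^ length xs * count₂ (λ y z → refine P i β y z ∧ follows σ y z))
          ≡⟨ sym (*-assoc 2 (2 ^ length xs) _) ⟩
        2 ^ length (i ∷ xs) * count₂ (λ y z → refine P i β y z ∧ follows σ y z)
          ≡⟨ cong (2 ^ length (i ∷ xs) *_) (∑-cong (λ y → ∑-cong (λ z →
               cong χ (∧-assoc (P y z) (does (test i y z ≟ β)) (follows σ y z))))) ⟩
        2 ^ length (i ∷ xs) * count₂ (λ y z → P y z ∧ follows ((i , β) ∷ σ) y z) ∎)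
        where open ≤-Reasoning

    pigeonhole : ∀ xs P → Concentrated xs P
    pigeonhole [] P = [] , refl , ≤-reflexive (trans
      (∑-cong (λ y → ∑-cong (λ z → cong χ (sym (∧-identityʳ (P y z)))))) (sym (+-identityʳ _)))
    pigeonhole (i ∷ xs) P with larger-answer P i
    ... | β , half = extend i β half (pigeonhole xs (refine P i β))

module CompleteBipartite where

  open Counting
  open import Data.Nat using (ℕ; zero; suc; _+_; _*_; _∸_; _^_; _≤_; _<_; _≤ᵇ_; z≤n; s≤s; NonZero; >-nonZero)
  open import Data.Nat.Properties hiding (_≟_)
  open import Data.Nat.Tactic.RingSolver using (solve-∀)
  open import Data.Fin using (Fin; zero; suc; _≟_)
  open import Data.Bool using (Bool; true; false; not; _∧_; _∨_)
  open import Data.Product using (∃; _×_; _,_)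
  open import Relation.Binary.PropositionalEquality
  open import Relation.Nullary using (does; yes; no)

  count-insert : ∀ {n} (Y : Fin n → Bool) y → Y y ≡ false →
    count (λ i → Y i ∨ does (i ≟ y)) ≡ suc (count Y)
  count-insert {n} Y y y∉Y = begin
    count (λ i → Y i ∨ does (i ≟ y))          ≡⟨ ∑-cong pointwise ⟩
    ∑[ i < n ] (χ (Y i) + χ (does (i ≟ y)))   ≡⟨ ∑-distrib-+ (λ i → χ (Y i)) (λ i → χ (does (i ≟ y))) ⟩
    count Y + count (λ i → does (i ≟ y))      ≡⟨ cong (count Y +_) (singleton y) ⟩
    count Y + 1                               ≡⟨ +-comm (count Y) 1 ⟩
    suc (count Y)                             ∎
    where
    open ≡-Reasoning
    singleton : ∀ {n} (y : Fin n) → count (λ i → does (i ≟ y)) ≡ 1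
    singleton {suc n} zero = cong suc (trans (∑-const n 0) (*-zeroʳ n))
    singleton {suc n} (suc y) = singleton y
    pointwise : ∀ i → χ (Y i ∨ does (i ≟ y)) ≡ χ (Y i) + χ (does (i ≟ y))
    pointwise i with i ≟ y
    ... | yes refl rewrite y∉Y = refl
    ... | no _ with Y i
    ...   | true = refl
    ...   | false = refl

  -- A relation R on 'Fin b', read as a directed graph y → w.
  module _ {b : ℕ} (R : Fin b → Fin b → Bool) where

    in-degree : Fin b → ℕ
    in-degree w = ∑[ y < b ] χ (R y w)

    _∩N⁺_ : (Fin b → Bool) → Fin b → Fin b → Bool
    (W ∩N⁺ y) w = W w ∧ R y w

    greedy-step : ∀ D k (Y W : Fin b → Bool) → count Y ≡ k →
      (∀ w → W w ≡ true → D ≤ in-degree w) → 0 < (D ∸ k) * count W →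
      ∃ λ y → Y y ≡ false × (D ∸ k) * count W ≤ b * count (W ∩N⁺ y)
    greedy-step D k Y W |Y|≡k high pos = choose (∑-≤-max new-links (<-≤-trans pos total-new-links))
      where
      new-links : Fin b → ℕ
      new-links y = χ (not (Y y)) * count (W ∩N⁺ y)

      -- at most k in-neighbours of w lie in Y
      outside-Y : ∀ w → in-degree w ≤ ∑[ y < b ] (χ (not (Y y)) * χ (R y w)) + count Y
      outside-Y w = ≤-trans (∑-mono-≤ (λ y → pointwise (Y y) (R y w)))
        (≤-reflexive (∑-distrib-+ (λ y → χ (not (Y y)) * χ (R y w)) (λ y → χ (Y y))))
        where
        pointwise : ∀ u r → χ r ≤ χ (not u) * χ r + χ u
        pointwise true true = s≤s z≤n
        pointwise true false = z≤n
        pointwise false true = s≤s z≤n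
        pointwise false false = z≤n

      per-vertex : ∀ w → (D ∸ k) * χ (W w) ≤ ∑[ y < b ] (χ (not (Y y)) * χ (W w ∧ R y w))
      per-vertex w with W w in w∈W
      ... | false = ≤-trans (≤-reflexive (*-zeroʳ (D ∸ k))) z≤n
      ... | true = begin
        (D ∸ k) * 1                                      ≡⟨ *-identityʳ (D ∸ k) ⟩
        D ∸ k                                            ≤⟨ ∸-monoˡ-≤ k (≤-trans (high w w∈W) (outside-Y w)) ⟩
        ∑[ y < b ] (χ (not (Y y)) * χ (R y w)) + count Y ∸ k
          ≡⟨ cong (λ n → ∑[ y < b ] (χ (not (Y y)) * χ (R y w)) + n ∸ k) |Y|≡k ⟩
        ∑[ y < b ] (χ (not (Y y)) * χ (R y w)) + k ∸ k   ≡⟨ m+n∸n≡m _ k ⟩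
        ∑[ y < b ] (χ (not (Y y)) * χ (R y w))           ∎
        where open ≤-Reasoning

      total-new-links : (D ∸ k) * count W ≤ sum new-links
      total-new-links = begin
        (D ∸ k) * count W
          ≡⟨ *-distribˡ-sum (D ∸ k) (λ w → χ (W w)) ⟩
        ∑[ w < b ] ((D ∸ k) * χ (W w))
          ≤⟨ ∑-mono-≤ per-vertex ⟩
        ∑[ w < b ] ∑[ y < b ] (χ (not (Y y)) * χ (W w ∧ R y w))
          ≡⟨ ∑-comm (λ w y → χ (not (Y y)) * χ (W w ∧ R y w)) ⟩
        ∑[ y < b ] ∑[ w < b ] (χ (not (Y y)) * χ (W w ∧ R y w))
          ≡⟨ ∑-cong (λ y → sym (*-distribˡ-sum (χ (not (Y y))) (λ w → χ (W w ∧ R y w)))) ⟩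
        sum new-links ∎
        where open ≤-Reasoning

      -- the maximiser lies outside Y, since new-links vanishes on Y
      choose : (∃ λ y → sum new-links ≤ b * new-links y) →
        ∃ λ y → Y y ≡ false × (D ∸ k) * count W ≤ b * count (W ∩N⁺ y)
      choose (y , avg≤) with Y y in eq
      ... | false = y , eq , ≤-trans total-new-links
                                     (≤-trans avg≤ (≤-reflexive (cong (b *_) (+-identityʳ _))))
      ... | true with <-≤-trans pos (≤-trans total-new-links (≤-trans avg≤ (≤-reflexive (*-zeroʳ b))))
      ...   | ()

    -- Greedy embedding of a complete bipartite graph: starting from a set W₀
    -- of vertices of in-degree ≥ D, repeatedly add the vertex chosen by
    -- 'greedy-step' to Y and shrink W to its common out-neighbourhood.
    module Greedy (D t : ℕ) (W₀ : Fin b → Bool) (W₀-high : ∀ w → W₀ w ≡ true → D ≤ in-degree w)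
                  (W₀-nonempty : 0 < count W₀) (t<D : t < D) where

      record Stage (k : ℕ) : Set where
        field
          Y W : Fin b → Bool
          |Y|≡k : count Y ≡ k
          W-high : ∀ w → W w ≡ true → D ≤ in-degree w
          complete : ∀ y w → Y y ≡ true → W w ≡ true → R y w ≡ true
          W-large : count W₀ * (D ∸ t) ^ k ≤ b ^ k * count W

      start : Stage 0
      start = record
        { Y = λ _ → false ; W = W₀ ; |Y|≡k = trans (∑-const b 0) (*-zeroʳ b) ; W-high = W₀-high
        ; complete = λ { _ _ () _ }
        ; W-large = ≤-reflexive (trans (*-identityʳ _) (sym (+-identityʳ _))) }

      W-nonempty : ∀ {k} (s : Stage k) → 0 < count (Stage.W s)
      W-nonempty {k} s = m*n>0⇒n>0 (b ^ k) (<-≤-trans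
        (*-mono-< W₀-nonempty (m^n>0 (D ∸ t) {{>-nonZero (m<n⇒0<n∸m t<D)}} k)) (Stage.W-large s))

      advance : ∀ {k} → k < t → (s : Stage k) → ∀ y → Stage.Y s y ≡ false →
        (D ∸ k) * count (Stage.W s) ≤ b * count (Stage.W s ∩N⁺ y) → Stage (suc k)
      advance {k} k<t s y y∉Y links = record
        { Y = λ i → Y i ∨ does (i ≟ y)
        ; W = W ∩N⁺ y
        ; |Y|≡k = trans (count-insert Y y y∉Y) (cong suc |Y|≡k)
        ; W-high = λ w w∈W′ → W-high w (∧-true₁ w∈W′)
        ; complete = complete′
        ; W-large = W-large′ }
        where
        open Stage s
        complete′ : ∀ i w → (Y i ∨ does (i ≟ y)) ≡ true → (W ∩N⁺ y) w ≡ true → R i w ≡ true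
        complete′ i w i∈Y′ w∈W′ with i ≟ y | Y i in i∈Y | W w in w∈W
        ... | yes refl | _ | true = w∈W′
        ... | no _ | true | true = complete i w i∈Y w∈W
        W-large′ : count W₀ * (D ∸ t) ^ suc k ≤ b ^ suc k * count (W ∩N⁺ y)
        W-large′ = begin
          count W₀ * (D ∸ t) ^ suc k        ≡⟨ rearrange₁ (count W₀) (D ∸ t) ((D ∸ t) ^ k) ⟩
          count W₀ * (D ∸ t) ^ k * (D ∸ t)  ≤⟨ *-mono-≤ W-large (∸-monoʳ-≤ D (<⇒≤ k<t)) ⟩
          b ^ k * count W * (D ∸ k)         ≡⟨ rearrange₂ (b ^ k) (count W) (D ∸ k) ⟩
          b ^ k * ((D ∸ k) * count W)       ≤⟨ *-monoʳ-≤ (b ^ k) links ⟩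
          b ^ k * (b * count (W ∩N⁺ y))     ≡⟨ rearrange₃ (b ^ k) b _ ⟩
          b ^ suc k * count (W ∩N⁺ y)       ∎
          where
          open ≤-Reasoning
          rearrange₁ : ∀ x d e → x * (d * e) ≡ x * e * d
          rearrange₁ = solve-∀
          rearrange₂ : ∀ x y z → x * y * z ≡ x * (z * y)
          rearrange₂ = solve-∀
          rearrange₃ : ∀ x y z → x * (y * z) ≡ y * x * z
          rearrange₃ = solve-∀

      next : ∀ k → k < t → Stage k → Stage (suc k)
      next k k<t s with greedy-step D k (Stage.Y s) (Stage.W s) (Stage.|Y|≡k s) (Stage.W-high s)
                          (*-mono-< (m<n⇒0<n∸m (<-trans k<t t<D)) (W-nonempty s))
      ... | y , y∉Y , links = advance k<t s y y∉Y links

      stage : ∀ k → k ≤ t → Stage k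
      stage zero _ = start
      stage (suc k) k<t = next k k<t (stage k (<⇒≤ k<t))

    high : ℕ → Fin b → Bool
    high D w = D ≤ᵇ in-degree w

    high-sound : ∀ D w → high D w ≡ true → D ≤ in-degree w
    high-sound D w = ≤ᵇ-true

    -- If R has at least 2bD edges then at least D vertices have in-degree ≥ D,
    -- as the others contribute fewer than bD edges in total.
    many-high : ∀ D → 0 < b → 2 * b * D ≤ count₂ R → D ≤ count (high D)
    many-high D b>0 dense = *-cancelˡ-≤ b {{>-nonZero b>0}} (+-cancelʳ-≤ (b * D) _ _ (begin
      b * D + b * D                         ≡⟨ double b D ⟩
      2 * b * D                             ≤⟨ dense ⟩
      count₂ R                              ≡⟨ ∑-comm (λ y w → χ (R y w)) ⟩
      ∑[ w < b ] in-degree w                ≤⟨ ∑-mono-≤ split ⟩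
      ∑[ w < b ] (b * χ (high D w) + D)     ≡⟨ ∑-distrib-+ (λ w → b * χ (high D w)) (λ _ → D) ⟩
      ∑[ w < b ] (b * χ (high D w)) + ∑[ w < b ] D
        ≡⟨ cong₂ _+_ (sym (*-distribˡ-sum b (λ w → χ (high D w)))) (∑-const b D) ⟩
      b * count (high D) + b * D            ∎))
      where
      open ≤-Reasoning
      double : ∀ b D → b * D + b * D ≡ 2 * b * D
      double = solve-∀
      split : ∀ w → in-degree w ≤ b * χ (high D w) + D
      split w with high D w in eq
      ... | true = ≤-trans (count≤n (λ y → R y w))
                           (≤-trans (≤-reflexive (sym (*-identityʳ b))) (m≤m+n (b * 1) D))
      ... | false = ≤-trans (<⇒≤ (≤ᵇ-false eq)) (m≤n+m D (b * 0))

  -- The numerical core of the Kővári–Sós–Turán bound: if W₀ shrank by at most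
  -- the factor ((D ∸ t)/b)ᵗ, and b ≤ 4K(D ∸ t), then at least t vertices remain.
  enough-left : ∀ b K D t n m → 0 < b → 2 * t < D → t * (4 * K) ^ t ≤ D → b ≤ K * suc D →
    D ≤ n → n * (D ∸ t) ^ t ≤ b ^ t * m → t ≤ m
  enough-left b K D t n m b>0 2t<D small b≤ D≤n shrink =
    *-cancelˡ-≤ (b ^ t) {{m^n≢0 b t {{>-nonZero b>0}}}} (begin
      b ^ t * t                          ≤⟨ *-monoˡ-≤ t (^-monoˡ-≤ t b≤4K[D∸t]) ⟩
      ((4 * K) * (D ∸ t)) ^ t * t        ≡⟨ cong (_* t) (^-distribʳ-* (4 * K) (D ∸ t) t) ⟩
      (4 * K) ^ t * (D ∸ t) ^ t * t      ≡⟨ rotate ((4 * K) ^ t) ((D ∸ t) ^ t) t ⟩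
      t * (4 * K) ^ t * (D ∸ t) ^ t      ≤⟨ *-monoˡ-≤ ((D ∸ t) ^ t) (≤-trans small D≤n) ⟩
      n * (D ∸ t) ^ t                    ≤⟨ shrink ⟩
      b ^ t * m                          ∎)
    where
    open ≤-Reasoning
    rotate : ∀ x y t → x * y * t ≡ t * x * y
    rotate = solve-∀
    t≤D∸t : t ≤ D ∸ t
    t≤D∸t = m+n≤o⇒m≤o∸n t (subst (_≤ D) (2*n≡n+n t) (<⇒≤ 2t<D))
    D≤2[D∸t] : D ≤ 2 * (D ∸ t)
    D≤2[D∸t] = begin
      D                     ≤⟨ m≤n+m∸n D t ⟩
      t + (D ∸ t)           ≤⟨ +-monoˡ-≤ (D ∸ t) t≤D∸t ⟩
      (D ∸ t) + (D ∸ t)     ≡⟨ sym (2*n≡n+n (D ∸ t)) ⟩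
      2 * (D ∸ t)           ∎
    b≤4K[D∸t] : b ≤ (4 * K) * (D ∸ t)
    b≤4K[D∸t] = begin
      b                      ≤⟨ b≤ ⟩
      K * suc D              ≤⟨ *-monoʳ-≤ K (≤-trans 1+D≤2D (*-monoʳ-≤ 2 D≤2[D∸t])) ⟩
      K * (2 * (2 * (D ∸ t))) ≡⟨ regroup K (D ∸ t) ⟩
      (4 * K) * (D ∸ t)      ∎
      where
      regroup : ∀ K x → K * (2 * (2 * x)) ≡ (4 * K) * x
      regroup = solve-∀
      1+D≤2D : suc D ≤ 2 * D
      1+D≤2D = ≤-trans (+-monoˡ-≤ D (≤-trans (s≤s z≤n) 2t<D)) (≤-reflexive (sym (2*n≡n+n D)))

  record Biclique {b : ℕ} (R : Fin b → Fin b → Bool) (t : ℕ) : Set where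
    field
      Y W : Fin b → Bool
      |Y|≡t : count Y ≡ t
      t≤|W| : t ≤ count W
      complete : ∀ y w → Y y ≡ true → W w ≡ true → R y w ≡ true

  complete-bipartite : ∀ {b} (R : Fin b → Fin b → Bool) K D t .{{_ : NonZero K}} → 0 < b →
    2 * b * D ≤ count₂ R → b ≤ K * suc D → 2 * t * (4 * K) ^ t < D → Biclique R t
  complete-bipartite {b} R K D t b>0 dense b≤ t-small = record
    { Y = Y ; W = W ; |Y|≡t = |Y|≡k ; complete = complete
    ; t≤|W| = enough-left b K D t (count (high R D)) (count W) b>0 2t<D t[4K]^t≤D b≤ D≤|W₀| W-large }
    where
    [4K]^t≥1 : 1 ≤ (4 * K) ^ t
    [4K]^t≥1 = m^n>0 (4 * K) {{m*n≢0 4 K}} t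
    2t≤2t[4K]^t : 2 * t ≤ 2 * t * (4 * K) ^ t
    2t≤2t[4K]^t = ≤-trans (≤-reflexive (sym (*-identityʳ (2 * t)))) (*-monoʳ-≤ (2 * t) [4K]^t≥1)
    2t<D : 2 * t < D
    2t<D = ≤-<-trans 2t≤2t[4K]^t t-small
    t[4K]^t≤D : t * (4 * K) ^ t ≤ D
    t[4K]^t≤D = ≤-trans (*-monoˡ-≤ ((4 * K) ^ t) (m≤n*m t 2)) (<⇒≤ t-small)
    t<D : t < D
    t<D = ≤-<-trans (m≤n*m t 2) 2t<D
    D≤|W₀| : D ≤ count (high R D)
    D≤|W₀| = many-high R D b>0 dense
    open Greedy R D t (high R D) (high-sound R D) (<-≤-trans (≤-<-trans z≤n t<D) D≤|W₀|) t<D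
    open Stage (stage t ≤-refl)

module LargeSize where

  open import Data.Nat using (ℕ; zero; suc; _+_; _*_; _∸_; _^_; _≤_; _<_; z≤n; s≤s; NonZero)
  open import Data.Nat.Properties
  open import Data.Nat.Tactic.RingSolver using (solve-∀)
  open import Relation.Binary.PropositionalEquality

  suc-≤-double : ∀ {x} n → x ≤ 2 ^ n → suc x ≤ 2 ^ suc n
  suc-≤-double n x≤ = +-mono-≤ (m^n>0 2 n) (≤-trans x≤ (≤-reflexive (sym (+-identityʳ (2 ^ n)))))

  n<2^n : ∀ n → n < 2 ^ n
  n<2^n zero = s≤s z≤n
  n<2^n (suc n) = suc-≤-double n (n<2^n n)

  -- For |A| = a and η = p/q, the densest link class of heavy pairs contains
  -- at least a 1/(8q·2ᵃ) fraction of the pairs of B (up to the factor b/(b-1)).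
  embedding-constant : ℕ → ℕ → ℕ
  embedding-constant a q = 8 * q * 2 ^ a

  -- The number of vertices of B needed to find a complete bipartite graph
  -- with parts of size t in a graph of density 1/(embedding-constant a q).
  required : ℕ → ℕ → ℕ → ℕ
  required a q t = K * suc (2 * t * (4 * K) ^ t) + 1
    where
    K : ℕ
    K = embedding-constant a q

  exponent : ℕ → ℕ → ℕ
  exponent a q = a * a + (7 + q) * a + (6 + q)

  required≤2^exponent : ∀ a q t → t ≤ a → required a q t ≤ 2 ^ exponent a q
  required≤2^exponent a q t t≤a = begin
    K * suc T + 1                              ≡⟨ +-comm (K * suc T) 1 ⟩
    suc (K * suc T)                            ≤⟨ s≤s (*-mono-≤ K≤ (suc-≤-double e T≤)) ⟩
    suc (2 ^ κ * 2 ^ suc e)                    ≤⟨ suc-≤-double (κ + suc e)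
                                                    (≤-reflexive (sym (^-distribˡ-+-* 2 κ (suc e)))) ⟩
    2 ^ suc (κ + suc e)                        ≡⟨ cong (2 ^_) (exponent-eq a q) ⟩
    2 ^ exponent a q                           ∎
    where
    open ≤-Reasoning
    K T κ e : ℕ
    K = embedding-constant a q
    T = 2 * t * (4 * K) ^ t
    κ = 3 + q + a
    e = suc a + (2 + κ) * a
    exponent-eq : ∀ a q → suc (3 + q + a + suc (suc a + (2 + (3 + q + a)) * a)) ≡
                          a * a + (7 + q) * a + (6 + q)
    exponent-eq = solve-∀
    K≤ : K ≤ 2 ^ κ
    K≤ = begin
      8 * q * 2 ^ a        ≤⟨ *-monoˡ-≤ (2 ^ a) (*-monoʳ-≤ 8 (<⇒≤ (n<2^n q))) ⟩
      8 * 2 ^ q * 2 ^ a    ≡⟨ cong (_* 2 ^ a) (sym (^-distribˡ-+-* 2 3 q)) ⟩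
      2 ^ (3 + q) * 2 ^ a  ≡⟨ sym (^-distribˡ-+-* 2 (3 + q) a) ⟩
      2 ^ κ                ∎
    [4K]^t≤ : (4 * K) ^ t ≤ 2 ^ ((2 + κ) * a)
    [4K]^t≤ = begin
      (4 * K) ^ t          ≤⟨ ^-monoˡ-≤ t (*-monoʳ-≤ 4 K≤) ⟩
      (4 * 2 ^ κ) ^ t      ≡⟨ cong (_^ t) (sym (^-distribˡ-+-* 2 2 κ)) ⟩
      (2 ^ (2 + κ)) ^ t    ≤⟨ ^-monoʳ-≤ (2 ^ (2 + κ)) {{m^n≢0 2 (2 + κ)}} t≤a ⟩
      (2 ^ (2 + κ)) ^ a    ≡⟨ ^-*-assoc 2 (2 + κ) a ⟩
      2 ^ ((2 + κ) * a)    ∎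
    T≤ : T ≤ 2 ^ e
    T≤ = begin
      2 * t * (4 * K) ^ t              ≤⟨ *-mono-≤ (*-monoʳ-≤ 2 (≤-trans t≤a (<⇒≤ (n<2^n a)))) [4K]^t≤ ⟩
      2 * 2 ^ a * 2 ^ ((2 + κ) * a)    ≡⟨ sym (^-distribˡ-+-* 2 (suc a) _) ⟩
      2 ^ e                            ∎

  -- If r·a + m ≤ r·m (that is, a ≤ (1 - 1/r)·m) and m > r(α + β), then
  -- a² + αa + β ≤ m²: the gap of at least m/r between a and m absorbs the
  -- linear terms.
  square-gap : ∀ r a m α β → r * a + m ≤ r * m → r * (α + β) + 1 ≤ m → a * a + α * a + β ≤ m * m
  square-gap zero a m α β gap large with ≤-trans large gap
  ... | ()
  square-gap r@(suc _) a m α β gap large =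
    expand (m ∸ a) (sym (m+[n∸m]≡n a≤m)) (m ∸ a ∸ suc (α + β)) (sym (m+[n∸m]≡n room))
    where
    a≤m : a ≤ m
    a≤m = *-cancelˡ-≤ r (≤-trans (m≤m+n (r * a) m) gap)
    m≤r[m∸a] : m ≤ r * (m ∸ a)
    m≤r[m∸a] = +-cancelˡ-≤ (r * a) _ _ (≤-trans gap (≤-reflexive
      (trans (cong (r *_) (sym (m+[n∸m]≡n a≤m))) (*-distribˡ-+ r a (m ∸ a)))))
    room : suc (α + β) ≤ m ∸ a
    room = *-cancelˡ-< r (α + β) (m ∸ a)
             (≤-trans (≤-reflexive (+-comm 1 (r * (α + β)))) (≤-trans large m≤r[m∸a]))
    expand : ∀ d → m ≡ a + d → ∀ k → d ≡ suc (α + β) + k → a * a + α * a + β ≤ m * m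
    expand d refl k refl = ≤-trans (m≤m+n _ _) (≤-reflexive (sym (square a α β k)))
      where
      square : ∀ a α β k → (a + (suc (α + β) + k)) * (a + (suc (α + β) + k)) ≡ a * a + α * a + β +
               (α * a + 2 * a * β + 2 * a * suc k + β * (α + β + k) + (α + suc k) * (α + β + suc k))
      square = solve-∀

  -- How large m must be, for a ≤ (s/r)·m with s < r and |B| ≥ 2^(m²)/d.
  m-threshold : ℕ → ℕ → ℕ → ℕ
  m-threshold r q d = r * ((7 + q) + (6 + q + d)) + 1

  2^exponent≤ : ∀ r s q d a m b .{{_ : NonZero d}} → r * a ≤ s * m → s < r →
    m-threshold r q d ≤ m → 2 ^ (m ^ 2) ≤ d * b → 2 ^ exponent a q ≤ b
  2^exponent≤ r s q d a m b ra≤sm s<r large 2^m²≤db = *-cancelˡ-≤ d (begin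
    d * 2 ^ exponent a q                    ≤⟨ *-monoˡ-≤ (2 ^ exponent a q) (<⇒≤ (n<2^n d)) ⟩
    2 ^ d * 2 ^ exponent a q                ≡⟨ sym (^-distribˡ-+-* 2 d (exponent a q)) ⟩
    2 ^ (d + exponent a q)                  ≡⟨ cong (2 ^_) (shift a q d) ⟩
    2 ^ (a * a + (7 + q) * a + (6 + q + d))
      ≤⟨ ^-monoʳ-≤ 2 (square-gap r a m (7 + q) (6 + q + d) gap large) ⟩
    2 ^ (m * m)                             ≡⟨ cong (λ k → 2 ^ (m * k)) (sym (*-identityʳ m)) ⟩
    2 ^ (m ^ 2)                             ≤⟨ 2^m²≤db ⟩
    d * b                                   ∎)
    where
    open ≤-Reasoning
    shift : ∀ a q d → d + (a * a + (7 + q) * a + (6 + q)) ≡ a * a + (7 + q) * a + (6 + q + d)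
    shift = solve-∀
    gap : r * a + m ≤ r * m
    gap = ≤-trans (+-monoˡ-≤ m ra≤sm) (≤-trans (≤-reflexive (+-comm (s * m) m)) (*-monoˡ-≤ m s<r))

module Assembly where

  open import Defs using (ABHypergraph; E; edgeCount; maxEdges)
  open Counting
  open HeavyPairs
  open LinkClasses
  open CompleteBipartite
  open LargeSize
  open import Data.Nat using (ℕ; zero; suc; _+_; _*_; _^_; _≤_; _<_; z≤n; s≤s; pred; _/_; _%_; NonZero; >-nonZero)
  open import Data.Nat.Properties
  open import Data.Nat.DivMod using (m≡m%n+[m/n]*n; m%n<n; m/n*n≤m)
  open import Data.Nat.Combinatorics using (_C_)
  open import Data.Nat.Tactic.RingSolver using (solve-∀)
  open import Data.Fin using (Fin)
  open import Data.Bool using (Bool; true; false; _∧_)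
  open import Data.List using (allFin; length)
  open import Data.List.Properties using (length-tabulate)
  open import Data.List.Membership.Propositional using (_∈_)
  open import Data.List.Membership.Propositional.Properties using (∈-allFin)
  open import Data.Product using (Σ; ∃; _×_; _,_; proj₁; proj₂)
  open import Data.Empty using (⊥)
  open import Relation.Binary.PropositionalEquality

  n*[m/n]≤m : ∀ m n .{{_ : NonZero n}} → n * (m / n) ≤ m
  n*[m/n]≤m m n = ≤-trans (≤-reflexive (*-comm n (m / n))) (m/n*n≤m m n)

  m<n*[1+m/n] : ∀ m n .{{_ : NonZero n}} → m < n * suc (m / n)
  m<n*[1+m/n] m n = begin-strict
    m                       ≡⟨ m≡m%n+[m/n]*n m n ⟩
    m % n + m / n * n       <⟨ +-monoˡ-< (m / n * n) (m%n<n m n) ⟩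
    n + m / n * n           ≡⟨ cong (n +_) (*-comm (m / n) n) ⟩
    n + n * (m / n)         ≡⟨ sym (*-suc n (m / n)) ⟩
    n * suc (m / n)         ∎
    where open ≤-Reasoning

  record CompleteTriple {a b : ℕ} (H : ABHypergraph a b) (s : ℕ) : Set where
    field
      A′ : Fin a → Bool
      B′ B″ : Fin b → Bool
      disjoint : ∀ y → B′ y ≡ true → B″ y ≡ true → ⊥
      |A′|≥s : s ≤ count A′
      |B′|≥s : s ≤ count B′
      |B″|≥s : s ≤ count B″
      edges : ∀ x y z → A′ x ≡ true → B′ y ≡ true → B″ z ≡ true → E H x y z ≡ true

  empty-triple : ∀ {b} (H : ABHypergraph 0 b) → CompleteTriple H 0
  empty-triple H = record
    { A′ = λ () ; B′ = λ _ → false ; B″ = λ _ → false ; disjoint = λ _ ()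
    ; |A′|≥s = z≤n ; |B′|≥s = z≤n ; |B″|≥s = z≤n ; edges = λ () }

  module Dense {a b : ℕ} (H : ABHypergraph a b) (p q : ℕ) (p>0 : 0 < p) (q>0 : 0 < q) (a>0 : 0 < a)
               (dense : p * maxEdges a b ≤ q * edgeCount H)
               (b-large : ∀ t → t ≤ a → required a q t ≤ b) where

    instance
      q≢0 : NonZero q
      q≢0 = >-nonZero q>0
      2q≢0 : NonZero (2 * q)
      2q≢0 = m*n≢0 2 q

    τ t : ℕ
    τ = (p * a) / (2 * q)
    t = suc τ

    pa≤2qt : p * a ≤ 2 * q * t
    pa≤2qt = <⇒≤ (m<n*[1+m/n] (p * a) (2 * q))

    many-heavy : p * (b C 2) ≤ 2 * q * count₂ (heavy H τ)
    many-heavy = heavy-pairs-dense H p q τ a>0 (n*[m/n]≤m (p * a) (2 * q)) dense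

    K : ℕ
    K = embedding-constant a q

    K>0 : 0 < K
    K>0 = *-mono-< (*-mono-< {0} {8} (s≤s z≤n) q>0) (m^n>0 2 a)

    b≥2 : 2 ≤ b
    b≥2 = ≤-trans (+-monoˡ-≤ 1 (≤-trans K>0 (≤-reflexive (sym (*-identityʳ K))))) (b-large 0 z≤n)

    b>0 : 0 < b
    b>0 = ≤-trans (s≤s z≤n) b≥2

    -- Step 2: the heavy pairs with the most common link (neighbourhood in A)
    -- form at least a 2⁻ᵃ fraction of them.
    in-link : Fin a → Fin b → Fin b → Bool
    in-link x y z = E H x y z

    concentrated : Concentrated in-link (allFin a) (heavy H τ)
    concentrated = pigeonhole in-link (allFin a) (heavy H τ)

    class : Fin b → Fin b → Bool
    class y z = heavy H τ y z ∧ follows in-link (proj₁ concentrated) y z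

    class-large : count₂ (heavy H τ) ≤ 2 ^ a * count₂ class
    class-large = subst (λ n → count₂ (heavy H τ) ≤ 2 ^ n * count₂ class)
                        (length-tabulate {n = a} (λ x → x)) (proj₂ (proj₂ concentrated))

    class-nonempty : 0 < count₂ class
    class-nonempty = m*n>0⇒n>0 (2 ^ a) (≤-trans pos class-large)
      where
      pos : 0 < count₂ (heavy H τ)
      pos = m*n>0⇒n>0 (2 * q) (≤-trans (*-mono-≤ p>0 (1≤C2 b b≥2)) many-heavy)

    -- Step 3: a representative pair; its link is the common link of the class.
    representative : ∃ λ y → ∃ λ z → class y z ≡ true
    representative with ∑-positive (λ y → count (class y)) class-nonempty
    ... | y , pos = y , count-witness (class y) pos

    y₀ z₀ : Fin b
    y₀ = proj₁ representative
    z₀ = proj₁ (proj₂ representative)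

    y₀z₀∈class : class y₀ z₀ ≡ true
    y₀z₀∈class = proj₂ (proj₂ representative)

    link : Fin a → Bool
    link x = E H x y₀ z₀

    same-link : ∀ y z → class y z ≡ true → ∀ x → E H x y z ≡ link x
    same-link y z yz∈class x =
      same-answers in-link (proj₁ concentrated) (∧-true₂ {heavy H τ y z} yz∈class)
        (∧-true₂ {heavy H τ y₀ z₀} y₀z₀∈class)
        (subst (x ∈_) (sym (proj₁ (proj₂ concentrated))) (∈-allFin x))

    t≤|link| : t ≤ count link
    t≤|link| = <ᵇ-true (∧-true₂ {ordered y₀ z₀} (∧-true₁ {heavy H τ y₀ z₀} y₀z₀∈class))

    t≤a : t ≤ a
    t≤a = ≤-trans t≤|link| (count≤n link)

    instance
      K≢0 : NonZero K
      K≢0 = >-nonZero K>0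
      b≢0 : NonZero b
      b≢0 = >-nonZero b>0
      4q2^a≢0 : NonZero (4 * q * 2 ^ a)
      4q2^a≢0 = m*n≢0 (4 * q) (2 ^ a) {{m*n≢0 4 q}} {{m^n≢0 2 a}}

    D : ℕ
    D = pred b / K

    b≤K[1+D] : b ≤ K * suc D
    b≤K[1+D] = ≤-trans (≤-reflexive (sym (suc-pred b))) (m<n*[1+m/n] (pred b) K)

    t-small : 2 * t * (4 * K) ^ t < D
    t-small = ≤-pred (*-cancelˡ-< K _ _ (≤-<-trans K[1+T]≤pred-b (m<n*[1+m/n] (pred b) K)))
      where
      K[1+T]≤pred-b : K * suc (2 * t * (4 * K) ^ t) ≤ pred b
      K[1+T]≤pred-b = suc[m]≤n⇒m≤pred[n] (≤-trans (≤-reflexive (+-comm 1 _)) (b-large t t≤a))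

    class-dense : 2 * b * D ≤ count₂ class
    class-dense = *-cancelʳ-≤ (2 * b * D) (count₂ class) (4 * q * 2 ^ a) (begin
      2 * b * D * (4 * q * 2 ^ a)        ≡⟨ regroup₁ b D q (2 ^ a) ⟩
      b * (K * D)                        ≤⟨ *-monoʳ-≤ b (n*[m/n]≤m (pred b) K) ⟩
      b * pred b                         ≡⟨ sym (double-C2 b) ⟩
      2 * (b C 2)                        ≤⟨ *-monoʳ-≤ 2 (m≤n*m (b C 2) p {{>-nonZero p>0}}) ⟩
      2 * (p * (b C 2))                  ≤⟨ *-monoʳ-≤ 2 many-heavy ⟩
      2 * (2 * q * count₂ (heavy H τ))   ≤⟨ *-monoʳ-≤ 2 (*-monoʳ-≤ (2 * q) class-large) ⟩
      2 * (2 * q * (2 ^ a * count₂ class))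
                                         ≡⟨ regroup₂ q (2 ^ a) (count₂ class) ⟩
      count₂ class * (4 * q * 2 ^ a)     ∎)
      where
      open ≤-Reasoning
      regroup₁ : ∀ b D q z → 2 * b * D * (4 * q * z) ≡ b * (8 * q * z * D)
      regroup₁ = solve-∀
      regroup₂ : ∀ q z e → 2 * (2 * q * (z * e)) ≡ e * (4 * q * z)
      regroup₂ = solve-∀

    triple : CompleteTriple H t
    triple = record
      { A′ = link ; B′ = Y ; B″ = W
      ; disjoint = λ y y∈Y y∈W →
          ordered-irrefl y (∧-true₁ {ordered y y} (∧-true₁ {heavy H τ y y} (complete y y y∈Y y∈W)))
      ; |A′|≥s = t≤|link| ; |B′|≥s = ≤-reflexive (sym |Y|≡t) ; |B″|≥s = t≤|W|
      ; edges = λ x y z x∈A′ y∈Y z∈W → trans (same-link y z (complete y z y∈Y z∈W) x) x∈A′ }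
      where open Biclique (complete-bipartite class K D t b>0 class-dense b≤K[1+D] t-small)

  dense⇒complete-triple : ∀ {a b} (H : ABHypergraph a b) p q → 0 < p → 0 < q →
    p * maxEdges a b ≤ q * edgeCount H → (∀ t → t ≤ a → required a q t ≤ b) →
    Σ ℕ λ s → p * a ≤ q * (2 * s) × CompleteTriple H s
  dense⇒complete-triple {zero} H p q _ _ _ _ =
    0 , ≤-trans (≤-reflexive (*-zeroʳ p)) z≤n , empty-triple H
  dense⇒complete-triple {suc a} H p q p>0 q>0 dense b-large =
    t , ≤-trans pa≤2qt (≤-reflexive (regroup q t)) , triple
    where
    open Dense H p q p>0 q>0 (s≤s z≤n) dense b-large
    regroup : ∀ q t → 2 * q * t ≡ q * (2 * t)
    regroup = solve-∀

open import Defs hiding (sym)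
open import Data.Nat using (ℕ; _≥_; _^_)
import Data.Nat
open import Data.Rational using (ℚ; 0ℚ; 1ℚ; _<_; _≤_; _*_; _/_)
open import Data.Integer using (+_)
open import Data.Product using (Σ; ∃; _×_; _,_)
open import Data.Fin using (Fin)
open import Data.Fin.Subset using (Subset; _∈_; _∩_; ∣_∣; Empty)
open import Data.Bool using (true)
open import Relation.Binary.PropositionalEquality using (_≡_)

open Counting
open RationalBridge
open LargeSize
open Assembly
open import Data.Nat using (zero; suc; z≤n; s≤s) renaming (_≤_ to _≤ₙ_; _*_ to _*ₙ_)
open import Data.Nat.Properties using (≤-trans; ≤-reflexive; *-monoʳ-≤; m≤n*m)
import Data.Rational.Properties as ℚ
open import Data.Nat.Coprimality using (Coprime)
open import Data.Rational using (mkℚ)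
open import Data.Bool using (Bool; false)
open import Data.Vec using (tabulate)
open import Data.Vec.Properties using ([]=⇒lookup; lookup∘tabulate)
open import Data.Fin.Subset.Properties using (x∈p∩q⁻)
open import Relation.Binary.PropositionalEquality using (refl; trans; sym; cong)

subset : ∀ {n} → (Fin n → Bool) → Subset n
subset = tabulate

∣subset∣ : ∀ {n} (P : Fin n → Bool) → ∣ subset P ∣ ≡ count P
∣subset∣ {zero} P = refl
∣subset∣ {suc n} P with P Data.Fin.zero
... | true = cong suc (∣subset∣ (λ i → P (Data.Fin.suc i)))
... | false = ∣subset∣ (λ i → P (Data.Fin.suc i))

∈subset : ∀ {n} (P : Fin n → Bool) x → x ∈ subset P → P x ≡ true
∈subset P x x∈P = trans (sym (lookup∘tabulate P x)) ([]=⇒lookup x∈P)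

CompleteSubsets : ℚ → ∀ {a b} → ABHypergraph a b → Set
CompleteSubsets η {a} {b} H =
  Σ (Subset a) λ A′ → Σ (Subset b) λ B′ → Σ (Subset b) λ B″ →
    Empty (B′ ∩ B″) ×
    (η * toℚ a ≤ toℚ (2 Data.Nat.* ∣ A′ ∣)) ×
    (η * toℚ a ≤ toℚ (2 Data.Nat.* ∣ B′ ∣)) ×
    (η * toℚ a ≤ toℚ (2 Data.Nat.* ∣ B″ ∣)) ×
    (∀ (x : Fin a) (y z : Fin b) → x ∈ A′ → y ∈ B′ → z ∈ B″ → E H x y z ≡ true)

as-subsets : ∀ {a b} (H : ABHypergraph a b) p q .(c : Coprime (suc p) (suc q)) →
  (Σ ℕ λ s → suc p *ₙ a ≤ₙ suc q *ₙ (2 *ₙ s) × CompleteTriple H s) →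
  CompleteSubsets (mkℚ (+ suc p) q c) H
as-subsets {a} H p q c (s , s-large , T) =
  subset A′ , subset B′ , subset B″ ,
  (λ { (y , y∈B′∩B″) → let (y∈B′ , y∈B″) = x∈p∩q⁻ (subset B′) (subset B″) y∈B′∩B″
                        in disjoint y (∈subset B′ y y∈B′) (∈subset B″ y y∈B″) }) ,
  large A′ |A′|≥s , large B′ |B′|≥s , large B″ |B″|≥s ,
  λ x y z x∈A′ y∈B′ z∈B″ →
    edges x y z (∈subset A′ x x∈A′) (∈subset B′ y y∈B′) (∈subset B″ z z∈B″)
  where
  open CompleteTriple T
  large : ∀ {n} (P : Fin n → Bool) → s ≤ₙ count P →
    mkℚ (+ suc p) q c * toℚ a ≤ toℚ (2 Data.Nat.* ∣ subset P ∣)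
  large P s≤|P| = ⇒scaled≤ (suc p) q c a _ (≤-trans s-large (*-monoʳ-≤ (suc q) (*-monoʳ-≤ 2
    (≤-trans s≤|P| (≤-reflexive (sym (∣subset∣ P)))))))

-- The density
-- hypothesis becomes p·|A|·(|B| choose 2) ≤ q·|E(H)| for η = p/q, and for
-- m ≥ m-threshold the bound |B| ≥ c₂·2^(m²) supplies every size required by
-- the embedding, since |A| = c₁m with c₁ < 1.
lemma5 : (c₁ c₂ η : ℚ) → 0ℚ < c₁ → c₁ < 1ℚ → 0ℚ < c₂ → c₂ < 1ℚ → 0ℚ < η →
    ∃ λ (M : ℕ) → ∀ (m : ℕ) → m ≥ M →
    ∀ (a b : ℕ) → toℚ a ≡ c₁ * toℚ m → c₂ * toℚ (2 ^ (m ^ 2)) ≤ toℚ b →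
    (H : ABHypergraph a b) →
    η * toℚ (maxEdges a b) ≤ toℚ (edgeCount H) →
    Σ (Subset a) λ A′ → Σ (Subset b) λ B′ → Σ (Subset b) λ B″ →
      Empty (B′ ∩ B″) ×
      (η * toℚ a ≤ toℚ (2 Data.Nat.* ∣ A′ ∣)) ×
      (η * toℚ a ≤ toℚ (2 Data.Nat.* ∣ B′ ∣)) ×
      (η * toℚ a ≤ toℚ (2 Data.Nat.* ∣ B″ ∣)) ×
      (∀ (x : Fin a) (y z : Fin b) → x ∈ A′ → y ∈ B′ → z ∈ B″ → E H x y z ≡ true)
lemma5 c₁ c₂ η 0<c₁ c₁<1 0<c₂ _ 0<η
  with positiveView c₁ 0<c₁ | positiveView c₂ 0<c₂ | positiveView η 0<η
... | positive s₁ r₁ coprime₁ | positive s₂ r₂ coprime₂ | positive p q coprime =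
  m-threshold (suc r₁) (suc q) (suc r₂) , λ m m≥M a b a≡c₁m b≥c₂2^m² H dense →
    as-subsets H p q coprime (dense⇒complete-triple H (suc p) (suc q) (s≤s z≤n) (s≤s z≤n)
      (scaled≤⇒ (suc p) q coprime (maxEdges a b) (edgeCount H) dense)
      (b-large m a b m≥M a≡c₁m b≥c₂2^m²))
  where
  c₁′ c₂′ : ℚ
  c₁′ = mkℚ (+ suc s₁) r₁ coprime₁
  c₂′ = mkℚ (+ suc s₂) r₂ coprime₂
  b-large : ∀ m a b → m ≥ m-threshold (suc r₁) (suc q) (suc r₂) → toℚ a ≡ c₁′ * toℚ m →
    c₂′ * toℚ (2 ^ (m ^ 2)) ≤ toℚ b → ∀ t → t ≤ₙ a → required a (suc q) t ≤ₙ b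
  b-large m a b m≥M a≡c₁m b≥c₂2^m² t t≤a = ≤-trans (required≤2^exponent a (suc q) t t≤a)
    (2^exponent≤ (suc r₁) (suc s₁) (suc q) (suc r₂) a m b
      (≤scaled⇒ (suc s₁) r₁ coprime₁ m a (ℚ.≤-reflexive a≡c₁m))
      (fraction<1 (suc s₁) r₁ coprime₁ c₁<1) m≥M
      (≤-trans (m≤n*m (2 ^ (m ^ 2)) (suc s₂)) (scaled≤⇒ (suc s₂) r₂ coprime₂ (2 ^ (m ^ 2)) b b≥c₂2^m²)))
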